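{- Let $t$ be an $\mathrm{SL}_2$-tiling with $t_{ij}=1$. Then $t_{xy}\neq 1$ for all $(x,y)\in\mathbb{Z}^2$ with $x<i$ and $y<j$, and for all $(x,y)\in\mathbb{Z}^2$ with $x>i$ and $y>j$.
   Context: An $\mathrm{SL}_2$-tiling is a map $t:\mathbb{Z}\times\mathbb{Z}\to\{1,2,3,\dots\}$, $(i,j)\mapsto t_{ij}$, with $t_{ij}t_{i+1,j+1}-t_{i,j+1}t_{i+1,j}=1$ for all $i,j$. -}

module Defs where

open import Data.Nat using (ℕ)
open import Data.Integer using (ℤ; +_; _+_; _-_; _*_; 1ℤ)
open import Relation.Binary.PropositionalEquality using (_≡_)

record SL₂Tiling : Set where
  field
    t        : ℤ → ℤ → ℤ
    positive : ∀ i j → 1ℤ Data.Integer.≤ t i j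
    det      : ∀ i j → t i j * t (i + 1ℤ) (j + 1ℤ) - t i (j + 1ℤ) * t (i + 1ℤ) j ≡ 1ℤ

module Submission where

-- Write a x y = |t x y| ∈ ℕ.  The determinant condition says
-- that every adjacent 2×2 minor of the tiling equals 1, so in particular
--   a x (y+1) · a (x+1) y  <  a x y · a (x+1) (y+1),
-- i.e. for two adjacent rows the ratio a x y / a (x+1) y strictly decreases
-- in y.  Strictly decreasing ratios compose along a chain, so first the ratio
-- of two adjacent rows decreases between any two columns y < y', and then,
-- applying the same chaining lemma in the row direction, every 2×2 minor
-- with x < x' and y < y' is positive:
--   a x' y · a x y'  <  a x y · a x' y'.
-- If both a x y and a x' y' were 1, the left-hand side (a product of
-- positive naturals) would be < 1, which is absurd.

open import Defs
open import Data.Integer using (ℤ; _<_; 1ℤ)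
open import Data.Product using (_×_)
open import Relation.Binary.PropositionalEquality using (_≡_; _≢_)

open import Data.Product using (_,_; Σ-syntax)
open import Data.Empty using (⊥)
open import Data.Nat as ℕ using (ℕ; zero; suc)
import Data.Nat.Properties as ℕP
open import Data.Integer as ℤ using (+_; ∣_∣) renaming (suc to sucℤ)
import Data.Integer.Properties as ℤP
import Data.Integer.Tactic.RingSolver as ℤSolver
import Data.Nat.Tactic.RingSolver as ℕSolver
open import Relation.Binary.PropositionalEquality using (refl; sym; cong; cong₂; subst; module ≡-Reasoning)

-- Every strictly larger integer is reached by adding a positive natural.
-- This turns statements "for all y < y'" into inductions on the gap.
gap : ∀ {y y'} → y < y' → Σ[ d ∈ ℕ ] y' ≡ y ℤ.+ + suc d
gap {y} {y'} y<y' = ∣ sucℤ y ℤ.- y' ∣ , (begin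
  y'                                  ≡⟨ shift y y' ⟩
  y ℤ.+ (1ℤ ℤ.+ (y' ℤ.- sucℤ y))      ≡⟨ cong (λ e → y ℤ.+ (1ℤ ℤ.+ e)) (sym distance) ⟩
  y ℤ.+ (1ℤ ℤ.+ + ∣ sucℤ y ℤ.- y' ∣)  ∎)
  where
  open ≡-Reasoning
  shift : ∀ y y' → y' ≡ y ℤ.+ (1ℤ ℤ.+ (y' ℤ.- (1ℤ ℤ.+ y)))
  shift = ℤSolver.solve-∀
  distance : + ∣ sucℤ y ℤ.- y' ∣ ≡ y' ℤ.- sucℤ y
  distance = ℤP.∣-∣-≤ (ℤP.i<j⇒suc[i]≤j y<y')

-- For sequences A, B : ℤ → ℕ, "A/B strictly decreases": the cross products
-- satisfy A y' · B y < A y · B y' whenever y < y' (no division needed).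
RatioDecreasing : (A B : ℤ → ℕ) → Set
RatioDecreasing A B = ∀ y y' → y < y' → A y' ℕ.* B y ℕ.< A y ℕ.* B y'

RatioDecreasingStep : (A B : ℤ → ℕ) → Set
RatioDecreasingStep A B = ∀ y → A (y ℤ.+ 1ℤ) ℕ.* B y ℕ.< A y ℕ.* B (y ℤ.+ 1ℤ)

-- Transitivity of the cross-product order a/b > a'/b' on pairs of naturals:
-- multiply the two inequalities and cancel the common factor a₁ · b₁.
cross-trans : ∀ a₀ b₀ a₁ b₁ a₂ b₂ →
  a₁ ℕ.* b₀ ℕ.< a₀ ℕ.* b₁ → a₂ ℕ.* b₁ ℕ.< a₁ ℕ.* b₂ → a₂ ℕ.* b₀ ℕ.< a₀ ℕ.* b₂
cross-trans a₀ b₀ a₁ b₁ a₂ b₂ p q = ℕP.*-cancelʳ-< (a₁ ℕ.* b₁) _ _ (begin-strict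
  (a₂ ℕ.* b₀) ℕ.* (a₁ ℕ.* b₁)  ≡⟨ swap-left a₂ b₀ a₁ b₁ ⟩
  (a₁ ℕ.* b₀) ℕ.* (a₂ ℕ.* b₁)  <⟨ ℕP.*-mono-< p q ⟩
  (a₀ ℕ.* b₁) ℕ.* (a₁ ℕ.* b₂)  ≡⟨ swap-right a₀ b₁ a₁ b₂ ⟩
  (a₀ ℕ.* b₂) ℕ.* (a₁ ℕ.* b₁)  ∎)
  where
  open ℕP.≤-Reasoning
  swap-left : ∀ a b c d → (a ℕ.* b) ℕ.* (c ℕ.* d) ≡ (c ℕ.* b) ℕ.* (a ℕ.* d)
  swap-left = ℕSolver.solve-∀
  swap-right : ∀ a b c d → (a ℕ.* b) ℕ.* (c ℕ.* d) ≡ (a ℕ.* d) ℕ.* (c ℕ.* b)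
  swap-right = ℕSolver.solve-∀

ratio-chain : ∀ A B → RatioDecreasingStep A B → RatioDecreasing A B
ratio-chain A B step y y' y<y' with gap y<y'
... | d , refl = along d
  where
  next : ∀ y e → y ℤ.+ (1ℤ ℤ.+ e) ≡ (y ℤ.+ e) ℤ.+ 1ℤ
  next = ℤSolver.solve-∀
  along : ∀ d → A (y ℤ.+ + suc d) ℕ.* B y ℕ.< A y ℕ.* B (y ℤ.+ + suc d)
  along zero    = step y
  along (suc d) rewrite next y (+ suc d) =
    cross-trans (A y) (B y) (A z) (B z) (A (z ℤ.+ 1ℤ)) (B (z ℤ.+ 1ℤ))
                (along d) (step z)
    where z = y ℤ.+ + suc d

module _ (T : SL₂Tiling) where
  open SL₂Tiling T

  a : ℤ → ℤ → ℕ
  a x y = ∣ t x y ∣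

  a-positive : ∀ x y → 1 ℕ.≤ a x y
  a-positive x y with t x y | positive x y
  ... | + n | ℤ.+≤+ 1≤n = 1≤n

  t≡a : ∀ x y → t x y ≡ + a x y
  t≡a x y = sym (ℤP.0≤i⇒+∣i∣≡i (ℤP.≤-trans (ℤ.+≤+ ℕ.z≤n) (positive x y)))

  adjacent-minor : ∀ x y →
    a x y ℕ.* a (x ℤ.+ 1ℤ) (y ℤ.+ 1ℤ) ≡ suc (a x (y ℤ.+ 1ℤ) ℕ.* a (x ℤ.+ 1ℤ) y)
  adjacent-minor x y = ℤP.+-injective (begin
    + (a x y ℕ.* a x₁ y₁)             ≡⟨ ℤP.pos-* (a x y) (a x₁ y₁) ⟩
    + a x y ℤ.* + a x₁ y₁             ≡⟨ cong₂ ℤ._*_ (sym (t≡a x y)) (sym (t≡a x₁ y₁)) ⟩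
    t x y ℤ.* t x₁ y₁                 ≡⟨ move (t x y ℤ.* t x₁ y₁) (t x y₁ ℤ.* t x₁ y) ⟩
    (t x y ℤ.* t x₁ y₁ ℤ.- t x y₁ ℤ.* t x₁ y) ℤ.+ t x y₁ ℤ.* t x₁ y
                                      ≡⟨ cong (ℤ._+ t x y₁ ℤ.* t x₁ y) (det x y) ⟩
    1ℤ ℤ.+ t x y₁ ℤ.* t x₁ y          ≡⟨ cong (λ e → 1ℤ ℤ.+ e) (cong₂ ℤ._*_ (t≡a x y₁) (t≡a x₁ y)) ⟩
    1ℤ ℤ.+ + a x y₁ ℤ.* + a x₁ y      ≡⟨ cong (λ e → 1ℤ ℤ.+ e) (sym (ℤP.pos-* (a x y₁) (a x₁ y))) ⟩
    + suc (a x y₁ ℕ.* a x₁ y)         ∎)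
    where
    open ≡-Reasoning
    x₁ = x ℤ.+ 1ℤ
    y₁ = y ℤ.+ 1ℤ
    move : ∀ p q → p ≡ (p ℤ.- q) ℤ.+ q
    move = ℤSolver.solve-∀

  adjacent-rows : ∀ x → RatioDecreasing (a x) (a (x ℤ.+ 1ℤ))
  adjacent-rows x = ratio-chain (a x) (a (x ℤ.+ 1ℤ))
    (λ y → ℕP.≤-reflexive (sym (adjacent-minor x y)))

  -- Every 2×2 minor with rows x < x' and columns y < y' is positive:
  -- chain the adjacent-row inequalities in the row direction.
  minor-positive : ∀ {x x' y y'} → x < x' → y < y' →
    a x' y ℕ.* a x y' ℕ.< a x y ℕ.* a x' y'
  minor-positive {x} {x'} {y} {y'} x<x' y<y' =
    ratio-chain (λ z → a z y) (λ z → a z y') row-step x x' x<x'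
    where
    row-step : RatioDecreasingStep (λ z → a z y) (λ z → a z y')
    row-step z rewrite ℕP.*-comm (a (z ℤ.+ 1ℤ) y) (a z y') =
      adjacent-rows z y y' y<y'

  no-diagonal-ones : ∀ {x x' y y'} → x < x' → y < y' →
    t x y ≡ 1ℤ → t x' y' ≡ 1ℤ → ⊥
  no-diagonal-ones {x} {x'} {y} {y'} x<x' y<y' t₁ t₂ =
    ℕP.<⇒≱ minor<1 (ℕP.*-mono-≤ (a-positive x' y) (a-positive x y'))
    where
    minor<1 : a x' y ℕ.* a x y' ℕ.< 1
    minor<1 = subst (λ m → a x' y ℕ.* a x y' ℕ.< m)
                    (cong₂ ℕ._*_ (cong ∣_∣ t₁) (cong ∣_∣ t₂)) (minor-positive x<x' y<y')

proposition6p2 : (T : SL₂Tiling) → (i j : ℤ) → SL₂Tiling.t T i j ≡ 1ℤ →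
    (∀ x y → x < i → y < j → SL₂Tiling.t T x y ≢ 1ℤ) ×
    (∀ x y → i < x → j < y → SL₂Tiling.t T x y ≢ 1ℤ)
proposition6p2 T i j tij≡1 =
  (λ x y x<i y<j txy≡1 → no-diagonal-ones T x<i y<j txy≡1 tij≡1) ,
  (λ x y i<x j<y txy≡1 → no-diagonal-ones T i<x j<y tij≡1 txy≡1)
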